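{- Let $P_1,P_2$ be centered paths with radii $r_1,r_2$, and for $0\le k\le\min(r_1,r_2)$ let $\pi(P_1,P_2,k)$ be the $k$-th product path. Then: (i) $\mathrm{rad}(\pi(P_1,P_2,k))=r_1+r_2-2k$; (ii) the radius of the product path $\pi(P_1,P_2,k)$ containing $(P_1(x),P_2(y))$ is $\rho(r_1,r_2,x,y)$; (iii) $\bigcup_{k=0}^{\min(r_1,r_2)}V(\pi(P_1,P_2,k))=V(P_1)\times V(P_2)$, and the union is disjoint; (iv) if $(P_1(x),P_2(y))=\pi(P_1,P_2,k)(j)$, then $j=x+y$.
   Context: A centered path $P$ of radius $\mathrm{rad}(P)=r\ge0$ has $r+1$ distinct vertices indexed $P(-r),P(-r+2),\dots,P(r)$ with directed edges $P(-r+2i)\to P(-r+2i+2)$, $0\le i<r$; $V(P)$ is its vertex set. For centered paths $P_1,P_2$ of radii $r_1,r_2$ and $0\le k\le\min(r_1,r_2)$, the product path $\pi(P_1,P_2,k)$ is the path with vertices in $V(P_1)\times V(P_2)$ and edges $(P_1(-r_1+2k),P_2(-r_2+2j))\to(P_1(-r_1+2k),P_2(-r_2+2j+2))$ for $0\le j\le r_2-k-1$ and $(P_1(-r_1+2k+2j),P_2(r_2-2k))\to(P_1(-r_1+2k+2j+2),P_2(r_2-2k))$ for $0\le j\le r_1-k-1$, regarded as a centered path (its vertices indexed $-R,-R+2,\dots,R$ from its initial vertex, $R$ its radius). For integers $r_1,r_2\ge0$ and $x,y$: $\rho(r_1,r_2,x,y)=r_1+y$ if $y\ge -x+r_2-r_1$,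 and $r_2-x$ otherwise. -}

module Defs where

open import Data.Nat as ℕ using (ℕ; zero; suc; _+_; _*_; _∸_; _≤_; _<_; _⊓_; s≤s)
open import Data.Nat.Properties as ℕP using ()
open import Data.Fin as Fin using (Fin; toℕ; fromℕ<; inject≤)
open import Data.Fin.Properties using (toℕ<n)
open import Data.Integer as ℤ using (ℤ; +_; -_)
open import Data.List as List using (List; length; tabulate; _++_)
open import Data.Product using (Σ; _×_; _,_)
open import Relation.Nullary using (yes; no)
open import Relation.Binary.PropositionalEquality using (_≡_; subst)
open import Function.Definitions using (Injective)

-- A centered path of radius r: r+1 pairwise distinct vertices.
-- The vertex at position i ∈ {0,…,r} is the vertex with (integer) index
-- P(-r+2i), see `idx` below.
record CenteredPath (V : Set) : Set where
  field
    radius   : ℕ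
    vertex   : Fin (suc radius) → V
    distinct : Injective _≡_ _≡_ vertex
open CenteredPath public

idx : ℕ → ℕ → ℤ
idx r i = - (+ r) ℤ.+ + (2 * i)

InProd : {V₁ V₂ : Set} → CenteredPath V₁ → CenteredPath V₂ → V₁ × V₂ → Set
InProd P₁ P₂ v = Σ (Fin (suc (radius P₁))) λ i₁ → Σ (Fin (suc (radius P₂))) λ i₂ →
  v ≡ (vertex P₁ i₁ , vertex P₂ i₂)

private
  lem : ∀ {k r j} → k ≤ r → j < r ∸ k → k + suc j < suc r
  lem {k} {r} {j} k≤r j<r∸k =
    s≤s (subst (k + suc j ≤_) (ℕP.m+[n∸m]≡n k≤r) (ℕP.+-monoʳ-≤ k j<r∸k))

-- The product path π(P₁,P₂,k), given as its sequence of vertices from the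
-- initial vertex (P₁(-r₁+2k), P₂(-r₂)) to the final vertex (P₁(r₁), P₂(r₂-2k)):
-- first (P₁(-r₁+2k), P₂(-r₂+2j)) for j = 0 … r₂-k,
-- then  (P₁(-r₁+2k+2j), P₂(r₂-2k)) for j = 1 … r₁-k.
-- Consecutive entries are exactly the edges listed in the definition.
prodPath : {V₁ V₂ : Set} (P₁ : CenteredPath V₁) (P₂ : CenteredPath V₂) (k : ℕ) →
           k ≤ radius P₁ ⊓ radius P₂ → List (V₁ × V₂)
prodPath P₁ P₂ k k≤ =
     tabulate {n = suc (r₂ ∸ k)}
       (λ j → vertex P₁ (fromℕ< (s≤s k≤r₁)) ,
              vertex P₂ (inject≤ j (s≤s (ℕP.m∸n≤m r₂ k))))
  ++ tabulate {n = r₁ ∸ k}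
       (λ j → vertex P₁ (fromℕ< (lem k≤r₁ (toℕ<n j))) ,
              vertex P₂ (fromℕ< (s≤s (ℕP.m∸n≤m r₂ k))))
  where
    r₁ = radius P₁
    r₂ = radius P₂
    k≤r₁ = ℕP.≤-trans k≤ (ℕP.m⊓n≤m r₁ r₂)

radL : {A : Set} → List A → ℕ
radL xs = length xs ∸ 1

ρ : ℕ → ℕ → ℤ → ℤ → ℤ
ρ r₁ r₂ x y with (- x ℤ.+ + r₂ ℤ.- + r₁) ℤ.≤? y
... | yes _ = + r₁ ℤ.+ y
... | no  _ = + r₂ ℤ.- x

{-# OPTIONS --safe #-}
module Submission where

open import Defs
open import Data.Nat using (ℕ; zero; suc; _+_; _*_; _∸_; _≤_; _<_; _⊓_; _≤?_; s≤s; s≤s⁻¹)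
import Data.Nat.Properties as ℕ
open import Data.Nat.Tactic.RingSolver using () renaming (solve-∀ to ℕ-solve)
open import Data.Integer
  using (ℤ; +_; -_; 0ℤ)
  renaming (_+_ to _+ℤ_; _-_ to _-ℤ_; _*_ to _*ℤ_; _⊓_ to _⊓ℤ_; _≤_ to _≤ℤ_; _≤?_ to _≤ℤ?_)
import Data.Integer.Properties as ℤ
open import Data.Integer.Tactic.RingSolver using () renaming (solve-∀ to ℤ-solve)
open import Data.Fin using (Fin; zero; suc; toℕ; fromℕ<; inject≤; cast)
import Data.Fin.Properties as Fin
open import Data.List using (_++_; length; lookup; tabulate)
import Data.List.Properties as List
open import Data.List.Membership.Propositional using (_∈_)
open import Data.List.Membership.Propositional.Properties using (∈-lookup)
open import Data.List.Relation.Unary.Any using (index)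
open import Data.List.Relation.Unary.Any.Properties using (lookup-index)
open import Data.Product using (Σ; ∃; ∃₂; _×_; _,_; proj₁; proj₂)
open import Data.Sum using (_⊎_; inj₁; inj₂)
open import Data.Empty using (⊥-elim)
open import Function using (_∘_)
open import Relation.Nullary using (yes; no)
open import Relation.Binary.PropositionalEquality
  using (_≡_; refl; sym; trans; cong; cong₂; subst; module ≡-Reasoning)
open ≡-Reasoning

-- Counting positions from the start of each path, the vertex at position n of π(P₁,P₂,k) is
-- (P₁ at a, P₂ at b) with a + b = n + k and min(a, r₂ - b) = k. So the vertex determines k
-- (disjointness), every (a, b) lies on the path k = min(a, r₂ - b) (covering), (iv) is
-- a + b = n + k read in centred indices, and (ii) holds because ρ(r₁, r₂, x, y) equals
-- r₁ + r₂ - min(x + r₁, r₂ - y), i.e. r₁ + r₂ - 2 min(a, r₂ - b) for x = 2a - r₁, y = 2b - r₂.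

pos-∸ : ∀ {m n} → n ≤ m → + (m ∸ n) ≡ + m -ℤ + n
pos-∸ {m} {n} n≤m = sym (trans (ℤ.m-n≡m⊖n m n) (ℤ.⊖-≥ n≤m))

j-i≡l-k⇒i≤j⇒k≤l : ∀ {i j k l} → j -ℤ i ≡ l -ℤ k → i ≤ℤ j → k ≤ℤ l
j-i≡l-k⇒i≤j⇒k≤l eq i≤j = ℤ.0≤i-j⇒j≤i (subst (0ℤ ≤ℤ_) eq (ℤ.i≤j⇒0≤j-i i≤j))

-- ρ switches branch exactly where its two candidate values x + r₁ and r₂ - y cross.
y-threshold≡[x+r₁]-[r₂-y] : ∀ r₁ r₂ x y → y -ℤ (- x +ℤ + r₂ -ℤ + r₁) ≡ (x +ℤ + r₁) -ℤ (+ r₂ -ℤ y)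
y-threshold≡[x+r₁]-[r₂-y] r₁ r₂ x y = ring (+ r₁) (+ r₂) x y
  where
  ring : ∀ (R₁ R₂ X Y : ℤ) → Y -ℤ (- X +ℤ R₂ -ℤ R₁) ≡ (X +ℤ R₁) -ℤ (R₂ -ℤ Y)
  ring = ℤ-solve

ρ≡r₁+r₂-min : ∀ r₁ r₂ x y →
  ρ r₁ r₂ x y ≡ (+ r₁ +ℤ + r₂) -ℤ ((x +ℤ + r₁) ⊓ℤ (+ r₂ -ℤ y))
ρ≡r₁+r₂-min r₁ r₂ x y with (- x +ℤ + r₂ -ℤ + r₁) ≤ℤ? y
... | yes threshold≤y = begin
  + r₁ +ℤ y                                      ≡⟨ ring (+ r₁) (+ r₂) y ⟩
  (+ r₁ +ℤ + r₂) -ℤ (+ r₂ -ℤ y)                  ≡⟨ cong ((+ r₁ +ℤ + r₂) -ℤ_) (ℤ.i≥j⇒i⊓j≡j r₂-y≤x+r₁) ⟨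
  (+ r₁ +ℤ + r₂) -ℤ ((x +ℤ + r₁) ⊓ℤ (+ r₂ -ℤ y)) ∎
  where
  ring : ∀ (R₁ R₂ Y : ℤ) → R₁ +ℤ Y ≡ (R₁ +ℤ R₂) -ℤ (R₂ -ℤ Y)
  ring = ℤ-solve
  r₂-y≤x+r₁ : + r₂ -ℤ y ≤ℤ x +ℤ + r₁
  r₂-y≤x+r₁ = j-i≡l-k⇒i≤j⇒k≤l (y-threshold≡[x+r₁]-[r₂-y] r₁ r₂ x y) threshold≤y
... | no threshold≰y = begin
  + r₂ -ℤ x                                      ≡⟨ ring (+ r₁) (+ r₂) x ⟩
  (+ r₁ +ℤ + r₂) -ℤ (x +ℤ + r₁)                  ≡⟨ cong ((+ r₁ +ℤ + r₂) -ℤ_) (ℤ.i≤j⇒i⊓j≡i x+r₁≤r₂-y) ⟨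
  (+ r₁ +ℤ + r₂) -ℤ ((x +ℤ + r₁) ⊓ℤ (+ r₂ -ℤ y)) ∎
  where
  ring : ∀ (R₁ R₂ X : ℤ) → R₂ -ℤ X ≡ (R₁ +ℤ R₂) -ℤ (X +ℤ R₁)
  ring = ℤ-solve
  x+r₁≤r₂-y : x +ℤ + r₁ ≤ℤ + r₂ -ℤ y
  x+r₁≤r₂-y = ℤ.<⇒≤ (ℤ.≰⇒> (threshold≰y ∘ j-i≡l-k⇒i≤j⇒k≤l (sym (y-threshold≡[x+r₁]-[r₂-y] r₁ r₂ x y))))

idx≡-r+2*i : ∀ r i → idx r i ≡ - + r +ℤ + 2 *ℤ + i
idx≡-r+2*i r i = cong (- + r +ℤ_) (ℤ.pos-* 2 i)

idx+r≡2*i : ∀ r i → idx r i +ℤ + r ≡ + (2 * i)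
idx+r≡2*i r i = ring (+ r) (+ (2 * i))
  where
  ring : ∀ (R T : ℤ) → - R +ℤ T +ℤ R ≡ T
  ring = ℤ-solve

r-idx≡2*[r∸i] : ∀ {r i} → i ≤ r → + r -ℤ idx r i ≡ + (2 * (r ∸ i))
r-idx≡2*[r∸i] {r} {i} i≤r = begin
  + r -ℤ idx r i                    ≡⟨ cong (+ r -ℤ_) (idx≡-r+2*i r i) ⟩
  + r -ℤ (- + r +ℤ + 2 *ℤ + i)      ≡⟨ ring (+ r) (+ i) ⟩
  + 2 *ℤ (+ r -ℤ + i)               ≡⟨ cong (+ 2 *ℤ_) (pos-∸ i≤r) ⟨
  + 2 *ℤ + (r ∸ i)                  ≡⟨ ℤ.pos-* 2 (r ∸ i) ⟨
  + (2 * (r ∸ i))                   ∎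
  where
  ring : ∀ (R I : ℤ) → R -ℤ (- R +ℤ + 2 *ℤ I) ≡ + 2 *ℤ (R -ℤ I)
  ring = ℤ-solve

idx-+ : ∀ r₁ r₂ i₁ i₂ → idx (r₁ + r₂) (i₁ + i₂) ≡ idx r₁ i₁ +ℤ idx r₂ i₂
idx-+ r₁ r₂ i₁ i₂ = begin
  idx (r₁ + r₂) (i₁ + i₂)                              ≡⟨ idx≡-r+2*i (r₁ + r₂) (i₁ + i₂) ⟩
  - + (r₁ + r₂) +ℤ + 2 *ℤ + (i₁ + i₂)                  ≡⟨ cong₂ (λ R I → - R +ℤ + 2 *ℤ I) (ℤ.pos-+ r₁ r₂) (ℤ.pos-+ i₁ i₂) ⟩
  - (+ r₁ +ℤ + r₂) +ℤ + 2 *ℤ (+ i₁ +ℤ + i₂)            ≡⟨ ring (+ r₁) (+ r₂) (+ i₁) (+ i₂) ⟩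
  (- + r₁ +ℤ + 2 *ℤ + i₁) +ℤ (- + r₂ +ℤ + 2 *ℤ + i₂)   ≡⟨ cong₂ _+ℤ_ (idx≡-r+2*i r₁ i₁) (idx≡-r+2*i r₂ i₂) ⟨
  idx r₁ i₁ +ℤ idx r₂ i₂                               ∎
  where
  ring : ∀ (R₁ R₂ I₁ I₂ : ℤ) →
         - (R₁ +ℤ R₂) +ℤ + 2 *ℤ (I₁ +ℤ I₂) ≡ (- R₁ +ℤ + 2 *ℤ I₁) +ℤ (- R₂ +ℤ + 2 *ℤ I₂)
  ring = ℤ-solve

idx-∸-2* : ∀ {r k} n → 2 * k ≤ r → idx (r ∸ 2 * k) n ≡ idx r (n + k)
idx-∸-2* {r} {k} n 2k≤r = begin
  idx (r ∸ 2 * k) n                        ≡⟨ idx≡-r+2*i (r ∸ 2 * k) n ⟩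
  - + (r ∸ 2 * k) +ℤ + 2 *ℤ + n            ≡⟨ cong (λ R → - R +ℤ + 2 *ℤ + n) (trans (pos-∸ 2k≤r) (cong (+ r -ℤ_) (ℤ.pos-* 2 k))) ⟩
  - (+ r -ℤ + 2 *ℤ + k) +ℤ + 2 *ℤ + n      ≡⟨ ring (+ r) (+ k) (+ n) ⟩
  - + r +ℤ + 2 *ℤ (+ n +ℤ + k)             ≡⟨ cong (λ I → - + r +ℤ + 2 *ℤ I) (ℤ.pos-+ n k) ⟨
  - + r +ℤ + 2 *ℤ + (n + k)                ≡⟨ idx≡-r+2*i r (n + k) ⟨
  idx r (n + k)                            ∎
  where
  ring : ∀ (R K N : ℤ) → - (R -ℤ + 2 *ℤ K) +ℤ + 2 *ℤ N ≡ - R +ℤ + 2 *ℤ (N +ℤ K)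
  ring = ℤ-solve

2*≤+ : ∀ {k m n} → k ≤ m → k ≤ n → 2 * k ≤ m + n
2*≤+ {k} k≤m k≤n = ℕ.+-mono-≤ k≤m (subst (_≤ _) (sym (ℕ.+-identityʳ k)) k≤n)

ρ-idx≡r₁+r₂∸2*min : ∀ {r₁ r₂ a b} → a ≤ r₁ → b ≤ r₂ →
  ρ r₁ r₂ (idx r₁ a) (idx r₂ b) ≡ + (r₁ + r₂ ∸ 2 * (a ⊓ (r₂ ∸ b)))
ρ-idx≡r₁+r₂∸2*min {r₁} {r₂} {a} {b} a≤r₁ b≤r₂ = begin
  ρ r₁ r₂ (idx r₁ a) (idx r₂ b)                                         ≡⟨ ρ≡r₁+r₂-min r₁ r₂ (idx r₁ a) (idx r₂ b) ⟩
  (+ r₁ +ℤ + r₂) -ℤ ((idx r₁ a +ℤ + r₁) ⊓ℤ (+ r₂ -ℤ idx r₂ b))           ≡⟨ cong₂ (λ u v → (+ r₁ +ℤ + r₂) -ℤ (u ⊓ℤ v)) (idx+r≡2*i r₁ a) (r-idx≡2*[r∸i] b≤r₂) ⟩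
  (+ r₁ +ℤ + r₂) -ℤ + ((2 * a) ⊓ (2 * (r₂ ∸ b)))                        ≡⟨ cong₂ (λ s t → s -ℤ + t) (ℤ.pos-+ r₁ r₂) (ℕ.*-distribˡ-⊓ 2 a (r₂ ∸ b)) ⟨
  + (r₁ + r₂) -ℤ + (2 * (a ⊓ (r₂ ∸ b)))                                ≡⟨ pos-∸ 2*min≤r₁+r₂ ⟨
  + (r₁ + r₂ ∸ 2 * (a ⊓ (r₂ ∸ b)))                                     ∎
  where
  2*min≤r₁+r₂ : 2 * (a ⊓ (r₂ ∸ b)) ≤ r₁ + r₂
  2*min≤r₁+r₂ = 2*≤+ (ℕ.≤-trans (ℕ.m⊓n≤m a _) a≤r₁) (ℕ.≤-trans (ℕ.m⊓n≤n a _) (ℕ.m∸n≤m r₂ b))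

m≤o∸n⇒n≤o∸m : ∀ {m n o} → n ≤ o → m ≤ o ∸ n → n ≤ o ∸ m
m≤o∸n⇒n≤o∸m {m} {n} {o} n≤o m≤o∸n = subst (_≤ o ∸ m) (ℕ.m∸[m∸n]≡n n≤o) (ℕ.∸-monoʳ-≤ o m≤o∸n)

[n∸k]+[m∸k]≡m+n∸2*k : ∀ {m n k} → k ≤ m → k ≤ n → (n ∸ k) + (m ∸ k) ≡ m + n ∸ 2 * k
[n∸k]+[m∸k]≡m+n∸2*k {m} {n} {k} k≤m k≤n = begin
  (n ∸ k) + (m ∸ k)    ≡⟨ ℕ.+-comm (n ∸ k) (m ∸ k) ⟩
  (m ∸ k) + (n ∸ k)    ≡⟨ ℕ.+-∸-assoc (m ∸ k) k≤n ⟨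
  (m ∸ k) + n ∸ k      ≡⟨ cong (_∸ k) (ℕ.+-∸-comm n k≤m) ⟨
  m + n ∸ k ∸ k        ≡⟨ ℕ.∸-+-assoc (m + n) k k ⟩
  m + n ∸ (k + k)      ≡⟨ cong (λ j → m + n ∸ (k + j)) (ℕ.+-identityʳ k) ⟨
  m + n ∸ 2 * k        ∎

-- Position r₁ r₂ k n a b: the vertex at position n of π(P₁,P₂,k) is the pair of the
-- vertices at positions a of P₁ and b of P₂ (all positions counted from the start).
data Position (r₁ r₂ k : ℕ) : ℕ → ℕ → ℕ → Set where
  vertical   : ∀ {n} → n ≤ r₂ ∸ k → Position r₁ r₂ k n k n
  horizontal : ∀ {m} → m < r₁ ∸ k → Position r₁ r₂ k (suc (r₂ ∸ k) + m) (k + suc m) (r₂ ∸ k)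

module _ {r₁ r₂ k : ℕ} where

  Position-sum : ∀ {n a b} → Position r₁ r₂ k n a b → a + b ≡ n + k
  Position-sum {n} (vertical _)       = ℕ.+-comm k n
  Position-sum (horizontal {m} _) = shuffle k m (r₂ ∸ k)
    where
    shuffle : ∀ k m d → k + suc m + d ≡ suc d + m + k
    shuffle = ℕ-solve

  Position-min : ∀ {n a b} → k ≤ r₂ → Position r₁ r₂ k n a b → a ⊓ (r₂ ∸ b) ≡ k
  Position-min k≤r₂ (vertical n≤r₂∸k) = ℕ.m≤n⇒m⊓n≡m (m≤o∸n⇒n≤o∸m k≤r₂ n≤r₂∸k)
  Position-min k≤r₂ (horizontal {m} _) = begin
    (k + suc m) ⊓ (r₂ ∸ (r₂ ∸ k))   ≡⟨ cong ((k + suc m) ⊓_) (ℕ.m∸[m∸n]≡n k≤r₂) ⟩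
    (k + suc m) ⊓ k                 ≡⟨ ℕ.m≥n⇒m⊓n≡n (ℕ.m≤m+n k (suc m)) ⟩
    k                               ∎

  Position-bound : ∀ {n a b} → Position r₁ r₂ k n a b → n < suc (r₂ ∸ k) + (r₁ ∸ k)
  Position-bound (vertical n≤r₂∸k) = s≤s (ℕ.≤-trans n≤r₂∸k (ℕ.m≤m+n (r₂ ∸ k) (r₁ ∸ k)))
  Position-bound (horizontal m<r₁∸k) = ℕ.+-monoʳ-< (suc (r₂ ∸ k)) m<r₁∸k

  Position-functional : ∀ {n n′ a a′ b b′} → Position r₁ r₂ k n a b → Position r₁ r₂ k n′ a′ b′ →
                        n ≡ n′ → a ≡ a′ × b ≡ b′
  Position-functional (vertical _) (vertical _) refl = refl , refl
  Position-functional (vertical n≤r₂∸k) (horizontal _) refl =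
    ⊥-elim (ℕ.n≮n _ (ℕ.m+n≤o⇒m≤o (suc (r₂ ∸ k)) n≤r₂∸k))
  Position-functional (horizontal _) (vertical n≤r₂∸k) refl =
    ⊥-elim (ℕ.n≮n _ (ℕ.m+n≤o⇒m≤o (suc (r₂ ∸ k)) n≤r₂∸k))
  Position-functional (horizontal {m} _) (horizontal {m′} _) n≡n′
    with ℕ.+-cancelˡ-≡ (suc (r₂ ∸ k)) m m′ n≡n′
  ... | refl = refl , refl

  horizontal-at : ∀ {a} → k < a → a ≤ r₁ → Position r₁ r₂ k (suc (r₂ ∸ k) + (a ∸ suc k)) a (r₂ ∸ k)
  horizontal-at {a} k<a a≤r₁ =
    subst (λ a′ → Position r₁ r₂ k (suc (r₂ ∸ k) + m) a′ (r₂ ∸ k)) k+suc-m≡a (horizontal m<r₁∸k)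
    where
    m : ℕ
    m = a ∸ suc k
    a∸k≡suc-m : a ∸ k ≡ suc m
    a∸k≡suc-m = ℕ.+-∸-assoc 1 k<a
    k+suc-m≡a : k + suc m ≡ a
    k+suc-m≡a = trans (cong (λ j → k + j) (sym a∸k≡suc-m)) (ℕ.m+[n∸m]≡n (ℕ.<⇒≤ k<a))
    m<r₁∸k : m < r₁ ∸ k
    m<r₁∸k = subst (_≤ r₁ ∸ k) a∸k≡suc-m (ℕ.∸-monoˡ-≤ k a≤r₁)

Position-complete : ∀ {r₁ r₂ a b} → a ≤ r₁ → b ≤ r₂ → ∃ λ n → Position r₁ r₂ (a ⊓ (r₂ ∸ b)) n a b
Position-complete {r₁} {r₂} {a} {b} a≤r₁ b≤r₂ with a ≤? r₂ ∸ b
... | yes a≤r₂∸b rewrite ℕ.m≤n⇒m⊓n≡m a≤r₂∸b = b , vertical (m≤o∸n⇒n≤o∸m b≤r₂ a≤r₂∸b)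
... | no a≰r₂∸b rewrite ℕ.m≥n⇒m⊓n≡n (ℕ.<⇒≤ (ℕ.≰⇒> a≰r₂∸b)) =
  _ , subst (Position r₁ r₂ (r₂ ∸ b) _ a) (ℕ.m∸[m∸n]≡n b≤r₂) (horizontal-at (ℕ.≰⇒> a≰r₂∸b) a≤r₁)

lookup-tabulate-cast : ∀ {A : Set} {n} (f : Fin n → A) (i : Fin (length (tabulate f))) →
  lookup (tabulate f) i ≡ f (cast (List.length-tabulate f) i)
lookup-tabulate-cast {n = suc n} f zero    = refl
lookup-tabulate-cast {n = suc n} f (suc i) = lookup-tabulate-cast (f ∘ suc) i

lookup-tabulate-++ : ∀ {A : Set} {m n} (f : Fin m → A) (g : Fin n → A)
  (j : Fin (length (tabulate f ++ tabulate g))) →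
  (∃ λ i → toℕ j ≡ toℕ i × lookup (tabulate f ++ tabulate g) j ≡ f i) ⊎
  (∃ λ i → toℕ j ≡ m + toℕ i × lookup (tabulate f ++ tabulate g) j ≡ g i)
lookup-tabulate-++ {m = zero} f g j =
  inj₂ (cast (List.length-tabulate g) j , sym (Fin.toℕ-cast _ j) , lookup-tabulate-cast g j)
lookup-tabulate-++ {m = suc m} f g zero = inj₁ (zero , refl , refl)
lookup-tabulate-++ {m = suc m} f g (suc j) with lookup-tabulate-++ (f ∘ suc) g j
... | inj₁ (i , j≡i , eq) = inj₁ (suc i , cong suc j≡i , eq)
... | inj₂ (i , j≡m+i , eq) = inj₂ (i , cong suc j≡m+i , eq)

module _ {V₁ V₂ : Set} (P₁ : CenteredPath V₁) (P₂ : CenteredPath V₂) where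

  private
    r₁ r₂ : ℕ
    r₁ = radius P₁
    r₂ = radius P₂

  module _ (k : ℕ) (hk : k ≤ r₁ ⊓ r₂) where

    private
      k≤r₁ : k ≤ r₁
      k≤r₁ = ℕ.m≤n⊓o⇒m≤n r₁ r₂ hk
      k≤r₂ : k ≤ r₂
      k≤r₂ = ℕ.m≤n⊓o⇒m≤o r₁ r₂ hk

    -- prodPath P₁ P₂ k hk is definitionally tabulate vertical-vertex ++ tabulate horizontal-vertex,
    -- since the bound proofs given to fromℕ< and inject≤ are irrelevant.
    vertical-vertex : Fin (suc (r₂ ∸ k)) → V₁ × V₂
    vertical-vertex j = vertex P₁ (fromℕ< (s≤s k≤r₁)) , vertex P₂ (inject≤ j (s≤s (ℕ.m∸n≤m r₂ k)))

    horizontal-vertex : Fin (r₁ ∸ k) → V₁ × V₂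
    horizontal-vertex j = vertex P₁ (fromℕ< (s≤s k+suc-j≤r₁)) , vertex P₂ (fromℕ< (s≤s (ℕ.m∸n≤m r₂ k)))
      where
      k+suc-j≤r₁ : k + suc (toℕ j) ≤ r₁
      k+suc-j≤r₁ = subst (_≤ r₁) (ℕ.+-comm (suc (toℕ j)) k) (ℕ.m≤o∸n⇒m+n≤o (suc (toℕ j)) k≤r₁ (Fin.toℕ<n j))

    length-prodPath : length (prodPath P₁ P₂ k hk) ≡ suc (r₂ ∸ k) + (r₁ ∸ k)
    length-prodPath =
      trans (List.length-++ (tabulate vertical-vertex))
            (cong₂ _+_ (List.length-tabulate vertical-vertex) (List.length-tabulate horizontal-vertex))

    radL-prodPath : radL (prodPath P₁ P₂ k hk) ≡ r₁ + r₂ ∸ 2 * k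
    radL-prodPath = trans (cong (_∸ 1) length-prodPath) ([n∸k]+[m∸k]≡m+n∸2*k k≤r₁ k≤r₂)

    lookup-prodPath : ∀ j → ∃₂ λ a b →
      lookup (prodPath P₁ P₂ k hk) j ≡ (vertex P₁ a , vertex P₂ b) × Position r₁ r₂ k (toℕ j) (toℕ a) (toℕ b)
    lookup-prodPath j with lookup-tabulate-++ vertical-vertex horizontal-vertex j
    ... | inj₁ (i , j≡i , eq) =
      _ , _ , eq , on-vertical i j≡i (Fin.toℕ-fromℕ< _) (Fin.toℕ-inject≤ i _)
      where
      on-vertical : ∀ {n a b} (c : Fin (suc (r₂ ∸ k))) → n ≡ toℕ c → a ≡ k → b ≡ toℕ c → Position r₁ r₂ k n a b
      on-vertical c refl refl refl = vertical (s≤s⁻¹ (Fin.toℕ<n c))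
    ... | inj₂ (i , j≡m+i , eq) =
      _ , _ , eq , on-horizontal i j≡m+i (Fin.toℕ-fromℕ< _) (Fin.toℕ-fromℕ< _)
      where
      on-horizontal : ∀ {n a b} (c : Fin (r₁ ∸ k)) →
        n ≡ suc (r₂ ∸ k) + toℕ c → a ≡ k + suc (toℕ c) → b ≡ r₂ ∸ k → Position r₁ r₂ k n a b
      on-horizontal c refl refl refl = horizontal (Fin.toℕ<n c)

    Position-of-lookup : ∀ i₁ i₂ j → (vertex P₁ i₁ , vertex P₂ i₂) ≡ lookup (prodPath P₁ P₂ k hk) j →
                         Position r₁ r₂ k (toℕ j) (toℕ i₁) (toℕ i₂)
    Position-of-lookup i₁ i₂ j eq with lookup-prodPath j
    ... | a , b , eq′ , pos
      with distinct P₁ (cong proj₁ (trans eq eq′)) | distinct P₂ (cong proj₂ (trans eq eq′))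
    ... | refl | refl = pos

    ∈-prodPath⇒Position : ∀ i₁ i₂ → (vertex P₁ i₁ , vertex P₂ i₂) ∈ prodPath P₁ P₂ k hk →
                          ∃ λ n → Position r₁ r₂ k n (toℕ i₁) (toℕ i₂)
    ∈-prodPath⇒Position i₁ i₂ v∈ = _ , Position-of-lookup i₁ i₂ (index v∈) (lookup-index v∈)

    Position⇒∈-prodPath : ∀ {n} i₁ i₂ → Position r₁ r₂ k n (toℕ i₁) (toℕ i₂) →
                          (vertex P₁ i₁ , vertex P₂ i₂) ∈ prodPath P₁ P₂ k hk
    Position⇒∈-prodPath {n} i₁ i₂ pos = subst (_∈ prodPath P₁ P₂ k hk) vertex-at-j (∈-lookup j)
      where
      j : Fin (length (prodPath P₁ P₂ k hk))
      j = fromℕ< (subst (n <_) (sym length-prodPath) (Position-bound pos))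
      vertex-at-j : lookup (prodPath P₁ P₂ k hk) j ≡ (vertex P₁ i₁ , vertex P₂ i₂)
      vertex-at-j with lookup-prodPath j
      ... | a , b , eq , pos′ with Position-functional pos′ pos (Fin.toℕ-fromℕ< _)
      ... | a≡i₁ , b≡i₂ rewrite Fin.toℕ-injective a≡i₁ | Fin.toℕ-injective b≡i₂ = eq

    radL-prodPath≡ρ : ∀ i₁ i₂ → (vertex P₁ i₁ , vertex P₂ i₂) ∈ prodPath P₁ P₂ k hk →
                      + radL (prodPath P₁ P₂ k hk) ≡ ρ r₁ r₂ (idx r₁ (toℕ i₁)) (idx r₂ (toℕ i₂))
    radL-prodPath≡ρ i₁ i₂ v∈ = begin
      + radL (prodPath P₁ P₂ k hk)                   ≡⟨ cong +_ radL-prodPath ⟩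
      + (r₁ + r₂ ∸ 2 * k)                            ≡⟨ cong (λ k′ → + (r₁ + r₂ ∸ 2 * k′)) k≡min ⟨
      + (r₁ + r₂ ∸ 2 * (toℕ i₁ ⊓ (r₂ ∸ toℕ i₂)))     ≡⟨ ρ-idx≡r₁+r₂∸2*min (Fin.toℕ≤pred[n] i₁) (Fin.toℕ≤pred[n] i₂) ⟨
      ρ r₁ r₂ (idx r₁ (toℕ i₁)) (idx r₂ (toℕ i₂))    ∎
      where
      k≡min : toℕ i₁ ⊓ (r₂ ∸ toℕ i₂) ≡ k
      k≡min = Position-min k≤r₂ (proj₂ (∈-prodPath⇒Position i₁ i₂ v∈))

    ∈-prodPath⇒InProd : ∀ v → v ∈ prodPath P₁ P₂ k hk → InProd P₁ P₂ v
    ∈-prodPath⇒InProd v v∈ with lookup-prodPath (index v∈)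
    ... | a , b , eq , _ = a , b , trans (lookup-index v∈) eq

    idx-lookup-prodPath : ∀ i₁ i₂ j → (vertex P₁ i₁ , vertex P₂ i₂) ≡ lookup (prodPath P₁ P₂ k hk) j →
      idx (radL (prodPath P₁ P₂ k hk)) (toℕ j) ≡ idx r₁ (toℕ i₁) +ℤ idx r₂ (toℕ i₂)
    idx-lookup-prodPath i₁ i₂ j eq = begin
      idx (radL (prodPath P₁ P₂ k hk)) (toℕ j)   ≡⟨ cong (λ R → idx R (toℕ j)) radL-prodPath ⟩
      idx (r₁ + r₂ ∸ 2 * k) (toℕ j)             ≡⟨ idx-∸-2* (toℕ j) (2*≤+ k≤r₁ k≤r₂) ⟩
      idx (r₁ + r₂) (toℕ j + k)                 ≡⟨ cong (idx (r₁ + r₂)) (Position-sum (Position-of-lookup i₁ i₂ j eq)) ⟨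
      idx (r₁ + r₂) (toℕ i₁ + toℕ i₂)           ≡⟨ idx-+ r₁ r₂ (toℕ i₁) (toℕ i₂) ⟩
      idx r₁ (toℕ i₁) +ℤ idx r₂ (toℕ i₂)        ∎

  prodPath-covers : ∀ i₁ i₂ →
    Σ ℕ λ k → Σ (k ≤ r₁ ⊓ r₂) λ hk → (vertex P₁ i₁ , vertex P₂ i₂) ∈ prodPath P₁ P₂ k hk
  prodPath-covers i₁ i₂ = _ , hk , Position⇒∈-prodPath _ hk i₁ i₂ (proj₂ (Position-complete i₁≤r₁ i₂≤r₂))
    where
    i₁≤r₁ : toℕ i₁ ≤ r₁
    i₁≤r₁ = Fin.toℕ≤pred[n] i₁
    i₂≤r₂ : toℕ i₂ ≤ r₂
    i₂≤r₂ = Fin.toℕ≤pred[n] i₂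
    hk : toℕ i₁ ⊓ (r₂ ∸ toℕ i₂) ≤ r₁ ⊓ r₂
    hk = ℕ.⊓-mono-≤ i₁≤r₁ (ℕ.m∸n≤m r₂ (toℕ i₂))

  prodPath-disjoint : ∀ k k′ (hk : k ≤ r₁ ⊓ r₂) (hk′ : k′ ≤ r₁ ⊓ r₂) v →
    v ∈ prodPath P₁ P₂ k hk → v ∈ prodPath P₁ P₂ k′ hk′ → k ≡ k′
  prodPath-disjoint k k′ hk hk′ v v∈ v∈′ with ∈-prodPath⇒InProd k hk v v∈
  ... | i₁ , i₂ , refl = trans (sym (min≡ k hk v∈)) (min≡ k′ hk′ v∈′)
    where
    min≡ : ∀ k (hk : k ≤ r₁ ⊓ r₂) → (vertex P₁ i₁ , vertex P₂ i₂) ∈ prodPath P₁ P₂ k hk →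
           toℕ i₁ ⊓ (r₂ ∸ toℕ i₂) ≡ k
    min≡ k hk v∈ = Position-min (ℕ.m≤n⊓o⇒m≤o r₁ r₂ hk) (proj₂ (∈-prodPath⇒Position k hk i₁ i₂ v∈))

lemma3p2 : {V₁ V₂ : Set} (P₁ : CenteredPath V₁) (P₂ : CenteredPath V₂) →
    -- (i)
    ((k : ℕ) (hk : k ≤ radius P₁ ⊓ radius P₂) →
      radL (prodPath P₁ P₂ k hk) ≡ radius P₁ + radius P₂ ∸ 2 * k)
    -- (ii)
    × ((k : ℕ) (hk : k ≤ radius P₁ ⊓ radius P₂)
       (i₁ : Fin _) (i₂ : Fin _) →
       (vertex P₁ i₁ , vertex P₂ i₂) ∈ prodPath P₁ P₂ k hk →
       + radL (prodPath P₁ P₂ k hk)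
         ≡ ρ (radius P₁) (radius P₂) (idx (radius P₁) (toℕ i₁)) (idx (radius P₂) (toℕ i₂)))
    -- (iii) union is V(P₁) × V(P₂) ...
    × ((k : ℕ) (hk : k ≤ radius P₁ ⊓ radius P₂) (v : V₁ × V₂) →
       v ∈ prodPath P₁ P₂ k hk → InProd P₁ P₂ v)
    × ((i₁ : Fin _) (i₂ : Fin _) →
       Σ ℕ λ k → Σ (k ≤ radius P₁ ⊓ radius P₂) λ hk →
         (vertex P₁ i₁ , vertex P₂ i₂) ∈ prodPath P₁ P₂ k hk)
    -- ... and the union is disjoint
    × ((k k′ : ℕ) (hk : k ≤ radius P₁ ⊓ radius P₂) (hk′ : k′ ≤ radius P₁ ⊓ radius P₂)
       (v : V₁ × V₂) → v ∈ prodPath P₁ P₂ k hk → v ∈ prodPath P₁ P₂ k′ hk′ → k ≡ k′)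
    -- (iv)
    × ((k : ℕ) (hk : k ≤ radius P₁ ⊓ radius P₂)
       (i₁ : Fin _) (i₂ : Fin _) (j : Fin (length (prodPath P₁ P₂ k hk))) →
       (vertex P₁ i₁ , vertex P₂ i₂) ≡ lookup (prodPath P₁ P₂ k hk) j →
       idx (radL (prodPath P₁ P₂ k hk)) (toℕ j)
         ≡ idx (radius P₁) (toℕ i₁) +ℤ idx (radius P₂) (toℕ i₂))
lemma3p2 P₁ P₂ =
    radL-prodPath P₁ P₂
  , radL-prodPath≡ρ P₁ P₂
  , ∈-prodPath⇒InProd P₁ P₂
  , prodPath-covers P₁ P₂
  , prodPath-disjoint P₁ P₂
  , idx-lookup-prodPath P₁ P₂
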